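{- Let $a>1$, $h\geq1$, $d\geq1$ be integers with $\gcd(a,d)=1$, let $A=(a^2,\ ha^2+d,\ ha^2+ad,\ ha^2+(a+1)d)$ and $f(x)=\sum_{r=0}^{a^2-1}x^{N_r}$. Then \begin{align*} f(x)&=\sum_{m=0}^{a-1}\sum_{i=0}^{a-m-1}x^{(m+i)ha^2+(m(a+1)+i)d}+\sum_{m=0}^{a-2}\sum_{i=0}^mx^{(m+1)ha^2+((m+1)a+i)d}\\ &=\frac{x^{a(ha^2+ad+d)}-x^{a(ha^2+d)}}{(1-x^{ad})(1-x^{ha^2+d})}+\frac{1-x^{a(ha^2+ad+d)}}{(1-x^{ha^2+d})(1-x^{ha^2+ad+d})}\\ &\quad+\frac{x^{a(ha^2+ad+d)}-x^{ha^2+ad+d}}{(1-x^{ha^2+ad+d})(1-x^d)}+\frac{x^{ha^2+ad}-x^{a^2(ha+d)}}{(1-x^{ha^2+ad})(1-x^d)}. \end{align*}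
   Context: For $A=(c,b_1,\dots,b_k)$ with $\gcd(A)=1$ and $0\le r\le c-1$, $N_r=\min\{a_0\in\mathbb{N} : a_0\equiv r \pmod c,\ a_0=\sum_{i}b_ix_i \text{ for some } x_i\in\mathbb{N}\}$ (here $c$ is the first entry of $A$, which is $a^2$ in the claim, and $(b_1,\dots,b_k)$ are the other entries). -}

module Defs where

open import Data.Nat using (ℕ; zero; suc; _+_; _*_; _≤_)
open import Data.Integer as ℤ using (ℤ; +_)
open import Data.Integer.Divisibility as ℤ∣ using ()
open import Data.Rational as ℚ using (ℚ; 0ℚ; 1ℚ)
open import Data.Product using (∃; Σ; _×_)
open import Data.List using (List; []; _∷_)
open import Relation.Binary.PropositionalEquality using (_≡_)
open import Relation.Nullary using (yes; no)

_≡_[mod_] : ℕ → ℕ → ℕ → Set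
m ≡ r [mod c ] = (+ c) ℤ∣.∣ ((+ m) ℤ.- (+ r))

Rep : List ℕ → ℕ → Set
Rep []       n = n ≡ 0
Rep (b ∷ bs) n = ∃ λ x → ∃ λ m → Rep bs m × n ≡ b * x + m

-- N is the value N_r for A = (c, bs) and residue r:
-- the least a₀ ∈ ℕ with a₀ ≡ r (mod c) and a₀ representable by bs
IsN : ℕ → List ℕ → ℕ → ℕ → Set
IsN c bs r N = (N ≡ r [mod c ] × Rep bs N)
             × (∀ a₀ → a₀ ≡ r [mod c ] → Rep bs a₀ → N ≤ a₀)

sumℚ : ℕ → (ℕ → ℚ) → ℚ
sumℚ zero    g = 0ℚ
sumℚ (suc n) g = sumℚ n g ℚ.+ g n

_^ℚ_ : ℚ → ℕ → ℚ
x ^ℚ zero  = 1ℚ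
x ^ℚ suc n = x ℚ.* (x ^ℚ n)

-- division of rationals; only ever applied (in the statement) to nonzero
-- denominators, the zero case is a harmless total-function convention
_÷′_ : ℚ → ℚ → ℚ
p ÷′ q with q ℚ.≟ 0ℚ
... | yes _  = 0ℚ
... | no q≢0 = ℚ._÷_ p q {{ℚ.≢-nonZero q≢0}}

{-# OPTIONS --safe #-}
module Submission where

-- A combination x b₁ + y b₂ + z b₃ of b₁ = ha² + d, b₂ = ha² + ad, b₃ = ha² + (a+1)d equals
-- s·ha² + t′·d with s = x + y + z and t′ = a(y + z) + (x + z), so it is ≡ t′d (mod a²).
-- Since d is a unit mod a², the residues r correspond to the t < a² with r ≡ td; write
-- t = ka + j in base a. If t′ ≡ t (mod a²) then t ≤ t′, and comparing digits gives
-- max(k, j) ≤ s; the bound is attained, so N_r = max(k, j)·ha² + td. Splitting the sum of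
-- x^{N_r} over the digit pairs into j ≥ k and j < k gives the double sums; their inner sums
-- are geometric, and clearing the denominators (nonzero as x ≠ ±1) gives the closed form.

open import Defs
open import Data.Nat.Base using (ℕ; _<_)
open import Data.Rational.Base using (ℚ)
open import Data.Nat.GCD using (gcd)
open import Relation.Binary.PropositionalEquality.Core using (_≡_)

module RationalAlgebra where

  open import Data.Nat.Base as ℕ using (ℕ; zero; suc; _<_)
  import Data.Nat.Properties as ℕ
  open import Data.Rational.Base as ℚ
    using (ℚ; 0ℚ; 1ℚ; _+_; _*_; _-_; -_; ∣_∣; NonNegative; Positive)
  import Data.Rational.Properties as ℚ
  open import Data.Rational.Solver using (module +-*-Solver)
  open +-*-Solver using (solve; _:=_; _:+_; _:*_; _:-_; con)
  open import Algebra.Properties.Group ℚ.+-0-group using (x∙y⁻¹≈ε⇒x≈y; ⁻¹-involutive)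
  import Algebra.Properties.CommutativeMonoid.Sum ℚ.+-0-commutativeMonoid as Fin-sum
  open import Data.Fin.Base using (Fin; toℕ; fromℕ<)
  open import Data.Fin.Properties using (toℕ-fromℕ<; toℕ<n; toℕ-injective)
  open import Data.Fin.Permutation using (permutation)
  open import Data.Sum.Base using ([_,_])
  open import Function.Base using (_∘_)
  open import Relation.Binary.PropositionalEquality
  open import Relation.Nullary using (yes; no; contradiction)
  open ≡-Reasoning

  ^ℚ-distribˡ-+-* : ∀ x m n → x ^ℚ (m ℕ.+ n) ≡ x ^ℚ m * x ^ℚ n
  ^ℚ-distribˡ-+-* x zero    n = sym (ℚ.*-identityˡ (x ^ℚ n))
  ^ℚ-distribˡ-+-* x (suc m) n =
    trans (cong (x *_) (^ℚ-distribˡ-+-* x m n)) (sym (ℚ.*-assoc x (x ^ℚ m) (x ^ℚ n)))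

  ^ℚ-*-assoc : ∀ x m n → (x ^ℚ n) ^ℚ m ≡ x ^ℚ (m ℕ.* n)
  ^ℚ-*-assoc x zero    n = refl
  ^ℚ-*-assoc x (suc m) n =
    trans (cong (x ^ℚ n *_) (^ℚ-*-assoc x m n)) (sym (^ℚ-distribˡ-+-* x n (m ℕ.* n)))

  ^ℚ-distribʳ-* : ∀ x y n → (x * y) ^ℚ n ≡ x ^ℚ n * y ^ℚ n
  ^ℚ-distribʳ-* x y zero    = refl
  ^ℚ-distribʳ-* x y (suc n) = begin
    x * y * (x * y) ^ℚ n      ≡⟨ cong (x * y *_) (^ℚ-distribʳ-* x y n) ⟩
    x * y * (x ^ℚ n * y ^ℚ n) ≡⟨ solve 4 (λ x y p q → x :* y :* (p :* q) := x :* p :* (y :* q))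
                                      refl x y (x ^ℚ n) (y ^ℚ n) ⟩
    x * x ^ℚ n * (y * y ^ℚ n) ∎

  ^ℚ-+-* : ∀ x m p i q → x ^ℚ (m ℕ.* p ℕ.+ i ℕ.* q) ≡ (x ^ℚ p) ^ℚ m * (x ^ℚ q) ^ℚ i
  ^ℚ-+-* x m p i q = trans (^ℚ-distribˡ-+-* x (m ℕ.* p) (i ℕ.* q))
                           (sym (cong₂ _*_ (^ℚ-*-assoc x m p) (^ℚ-*-assoc x i q)))

  sumℚ-cong : ∀ n {f g : ℕ → ℚ} → (∀ i → i < n → f i ≡ g i) → sumℚ n f ≡ sumℚ n g
  sumℚ-cong zero    f≡g = refl
  sumℚ-cong (suc n) f≡g =
    cong₂ _+_ (sumℚ-cong n (λ i i<n → f≡g i (ℕ.m<n⇒m<1+n i<n))) (f≡g n (ℕ.n<1+n n))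

  sumℚ-split : ∀ m n g → sumℚ (m ℕ.+ n) g ≡ sumℚ m g + sumℚ n (λ i → g (m ℕ.+ i))
  sumℚ-split m zero    g = trans (cong (λ k → sumℚ k g) (ℕ.+-identityʳ m)) (sym (ℚ.+-identityʳ _))
  sumℚ-split m (suc n) g = begin
    sumℚ (m ℕ.+ suc n) g                                   ≡⟨ cong (λ k → sumℚ k g) (ℕ.+-suc m n) ⟩
    sumℚ (m ℕ.+ n) g + g (m ℕ.+ n)                         ≡⟨ cong (_+ g (m ℕ.+ n)) (sumℚ-split m n g) ⟩
    sumℚ m g + sumℚ n (λ i → g (m ℕ.+ i)) + g (m ℕ.+ n)    ≡⟨ ℚ.+-assoc (sumℚ m g) _ _ ⟩
    sumℚ m g + sumℚ (suc n) (λ i → g (m ℕ.+ i))            ∎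

  sumℚ-suc : ∀ n g → sumℚ (suc n) g ≡ g 0 + sumℚ n (g ∘ suc)
  sumℚ-suc n g = trans (sumℚ-split 1 n g) (cong (_+ sumℚ n (g ∘ suc)) (ℚ.+-identityˡ (g 0)))

  sumℚ-* : ∀ m n g → sumℚ (m ℕ.* n) g ≡ sumℚ m (λ k → sumℚ n (λ j → g (k ℕ.* n ℕ.+ j)))
  sumℚ-* zero    n g = refl
  sumℚ-* (suc m) n g = begin
    sumℚ (n ℕ.+ m ℕ.* n) g
      ≡⟨ cong (λ k → sumℚ k g) (ℕ.+-comm n (m ℕ.* n)) ⟩
    sumℚ (m ℕ.* n ℕ.+ n) g
      ≡⟨ sumℚ-split (m ℕ.* n) n g ⟩
    sumℚ (m ℕ.* n) g + sumℚ n (λ j → g (m ℕ.* n ℕ.+ j))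
      ≡⟨ cong (_+ sumℚ n (λ j → g (m ℕ.* n ℕ.+ j))) (sumℚ-* m n g) ⟩
    sumℚ (suc m) (λ k → sumℚ n (λ j → g (k ℕ.* n ℕ.+ j))) ∎

  sumℚ-distrib-+ : ∀ n f g → sumℚ n (λ i → f i + g i) ≡ sumℚ n f + sumℚ n g
  sumℚ-distrib-+ zero    f g = refl
  sumℚ-distrib-+ (suc n) f g = begin
    sumℚ n (λ i → f i + g i) + (f n + g n)  ≡⟨ cong (_+ (f n + g n)) (sumℚ-distrib-+ n f g) ⟩
    sumℚ n f + sumℚ n g + (f n + g n)       ≡⟨ solve 4 (λ s t p q → s :+ t :+ (p :+ q) := s :+ p :+ (t :+ q))
                                                      refl (sumℚ n f) (sumℚ n g) (f n) (g n) ⟩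
    sumℚ n f + f n + (sumℚ n g + g n)       ∎

  sumℚ-distrib-minus : ∀ n f g → sumℚ n (λ i → f i - g i) ≡ sumℚ n f - sumℚ n g
  sumℚ-distrib-minus zero    f g = refl
  sumℚ-distrib-minus (suc n) f g = begin
    sumℚ n (λ i → f i - g i) + (f n - g n)  ≡⟨ cong (_+ (f n - g n)) (sumℚ-distrib-minus n f g) ⟩
    sumℚ n f - sumℚ n g + (f n - g n)       ≡⟨ solve 4 (λ s t p q → s :- t :+ (p :- q) := s :+ p :- (t :+ q))
                                                      refl (sumℚ n f) (sumℚ n g) (f n) (g n) ⟩
    sumℚ n f + f n - (sumℚ n g + g n)       ∎

  *-distribˡ-sumℚ : ∀ n c f → c * sumℚ n f ≡ sumℚ n (λ i → c * f i)
  *-distribˡ-sumℚ zero    c f = ℚ.*-zeroʳ c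
  *-distribˡ-sumℚ (suc n) c f =
    trans (ℚ.*-distribˡ-+ c (sumℚ n f) (f n)) (cong (_+ c * f n) (*-distribˡ-sumℚ n c f))

  geometric-sum : ∀ y n → (1ℚ - y) * sumℚ n (y ^ℚ_) ≡ 1ℚ - y ^ℚ n
  geometric-sum y zero    = ℚ.*-zeroʳ (1ℚ - y)
  geometric-sum y (suc n) = begin
    (1ℚ - y) * (sumℚ n (y ^ℚ_) + y ^ℚ n)
      ≡⟨ solve 3 (λ y s p → (con 1ℚ :- y) :* (s :+ p) := (con 1ℚ :- y) :* s :+ (p :- y :* p))
               refl y (sumℚ n (y ^ℚ_)) (y ^ℚ n) ⟩
    (1ℚ - y) * sumℚ n (y ^ℚ_) + (y ^ℚ n - y * y ^ℚ n)
      ≡⟨ cong (_+ (y ^ℚ n - y * y ^ℚ n)) (geometric-sum y n) ⟩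
    1ℚ - y ^ℚ n + (y ^ℚ n - y * y ^ℚ n)
      ≡⟨ solve 2 (λ p q → con 1ℚ :- p :+ (p :- q) := con 1ℚ :- q) refl (y ^ℚ n) (y * y ^ℚ n) ⟩
    1ℚ - y * y ^ℚ n ∎

  shifted-geometric-sum : ∀ y n → (1ℚ - y) * sumℚ n (λ m → y ^ℚ suc m) ≡ y - y ^ℚ suc n
  shifted-geometric-sum y n = begin
    (1ℚ - y) * sumℚ n (λ m → y * y ^ℚ m)
      ≡⟨ cong ((1ℚ - y) *_) (*-distribˡ-sumℚ n y (y ^ℚ_)) ⟨
    (1ℚ - y) * (y * sumℚ n (y ^ℚ_))
      ≡⟨ solve 2 (λ y s → (con 1ℚ :- y) :* (y :* s) := y :* ((con 1ℚ :- y) :* s)) refl y (sumℚ n (y ^ℚ_)) ⟩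
    y * ((1ℚ - y) * sumℚ n (y ^ℚ_))
      ≡⟨ cong (y *_) (geometric-sum y n) ⟩
    y * (1ℚ - y ^ℚ n)
      ≡⟨ solve 2 (λ y p → y :* (con 1ℚ :- p) := y :- y :* p) refl y (y ^ℚ n) ⟩
    y - y * y ^ℚ n ∎

  weighted-geometric-sum : ∀ y n (f : ℕ → ℚ) (g : ℕ → ℕ) →
    (1ℚ - y) * sumℚ n (λ m → f m * sumℚ (g m) (y ^ℚ_)) ≡ sumℚ n f - sumℚ n (λ m → f m * y ^ℚ g m)
  weighted-geometric-sum y n f g = begin
    (1ℚ - y) * sumℚ n (λ m → f m * sumℚ (g m) (y ^ℚ_))   ≡⟨ *-distribˡ-sumℚ n (1ℚ - y) _ ⟩
    sumℚ n (λ m → (1ℚ - y) * (f m * sumℚ (g m) (y ^ℚ_))) ≡⟨ sumℚ-cong n (λ m _ → term m) ⟩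
    sumℚ n (λ m → f m - f m * y ^ℚ g m)                  ≡⟨ sumℚ-distrib-minus n f (λ m → f m * y ^ℚ g m) ⟩
    sumℚ n f - sumℚ n (λ m → f m * y ^ℚ g m)             ∎
    where
    term : ∀ m → (1ℚ - y) * (f m * sumℚ (g m) (y ^ℚ_)) ≡ f m - f m * y ^ℚ g m
    term m = begin
      (1ℚ - y) * (f m * sumℚ (g m) (y ^ℚ_))
        ≡⟨ solve 3 (λ y p s → (con 1ℚ :- y) :* (p :* s) := p :* ((con 1ℚ :- y) :* s))
                 refl y (f m) (sumℚ (g m) (y ^ℚ_)) ⟩
      f m * ((1ℚ - y) * sumℚ (g m) (y ^ℚ_))
        ≡⟨ cong (f m *_) (geometric-sum y (g m)) ⟩
      f m * (1ℚ - y ^ℚ g m)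
        ≡⟨ solve 2 (λ p q → p :* (con 1ℚ :- q) := p :- p :* q) refl (f m) (y ^ℚ g m) ⟩
      f m - f m * y ^ℚ g m ∎

  sumℚ≡Fin-sum : ∀ n g → sumℚ n g ≡ Fin-sum.sum {n} (g ∘ toℕ)
  sumℚ≡Fin-sum zero    g = refl
  sumℚ≡Fin-sum (suc n) g = trans (sumℚ-suc n g) (cong (g 0 +_) (sumℚ≡Fin-sum n (g ∘ suc)))

  sumℚ-permute : ∀ n g (σ τ : ℕ → ℕ) →
                 (∀ i → i < n → σ i < n) → (∀ i → i < n → τ i < n) →
                 (∀ i → i < n → σ (τ i) ≡ i) → (∀ i → i < n → τ (σ i) ≡ i) →
                 sumℚ n (g ∘ σ) ≡ sumℚ n g
  sumℚ-permute n g σ τ σ<n τ<n στ τσ = begin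
    sumℚ n (g ∘ σ)                 ≡⟨ sumℚ≡Fin-sum n (g ∘ σ) ⟩
    Fin-sum.sum {n} (g ∘ σ ∘ toℕ)  ≡⟨ Fin-sum.sum-cong-≗ {n} (cong g ∘ sym ∘ toℕ-σᶠ) ⟩
    Fin-sum.sum {n} (g ∘ toℕ ∘ σᶠ) ≡⟨ Fin-sum.sum-permute (g ∘ toℕ) (permutation σᶠ τᶠ στᶠ τσᶠ) ⟨
    Fin-sum.sum {n} (g ∘ toℕ)      ≡⟨ sumℚ≡Fin-sum n g ⟨
    sumℚ n g                       ∎
    where
    σᶠ τᶠ : Fin n → Fin n
    σᶠ i = fromℕ< (σ<n (toℕ i) (toℕ<n i))
    τᶠ i = fromℕ< (τ<n (toℕ i) (toℕ<n i))
    toℕ-σᶠ : ∀ i → toℕ (σᶠ i) ≡ σ (toℕ i)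
    toℕ-σᶠ i = toℕ-fromℕ< _
    στᶠ : ∀ i → σᶠ (τᶠ i) ≡ i
    στᶠ i = toℕ-injective (trans (toℕ-fromℕ< _) (trans (cong σ (toℕ-fromℕ< _)) (στ (toℕ i) (toℕ<n i))))
    τσᶠ : ∀ i → τᶠ (σᶠ i) ≡ i
    τσᶠ i = toℕ-injective (trans (toℕ-fromℕ< _) (trans (cong τ (toℕ-fromℕ< _)) (τσ (toℕ i) (toℕ<n i))))

  *-cancelʳ-≡ : ∀ p q r → r ≢ 0ℚ → p * r ≡ q * r → p ≡ q
  *-cancelʳ-≡ p q r r≢0 pr≡qr = begin
    p                ≡⟨ ℚ.*-identityʳ p ⟨
    p * 1ℚ           ≡⟨ cong (p *_) (ℚ.*-inverseʳ r) ⟨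
    p * (r * ℚ.1/ r) ≡⟨ ℚ.*-assoc p r (ℚ.1/ r) ⟨
    p * r * ℚ.1/ r   ≡⟨ cong (_* ℚ.1/ r) pr≡qr ⟩
    q * r * ℚ.1/ r   ≡⟨ ℚ.*-assoc q r (ℚ.1/ r) ⟩
    q * (r * ℚ.1/ r) ≡⟨ cong (q *_) (ℚ.*-inverseʳ r) ⟩
    q * 1ℚ           ≡⟨ ℚ.*-identityʳ q ⟩
    q                ∎
    where instance _ = ℚ.≢-nonZero r≢0

  *-≢0 : ∀ {p q} → p ≢ 0ℚ → q ≢ 0ℚ → p * q ≢ 0ℚ
  *-≢0 {p} {q} p≢0 q≢0 pq≡0 = p≢0 (*-cancelʳ-≡ p 0ℚ q q≢0 (trans pq≡0 (sym (ℚ.*-zeroˡ q))))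

  ÷′-*-cancel : ∀ p q → q ≢ 0ℚ → (p ÷′ q) * q ≡ p
  ÷′-*-cancel p q q≢0 with q ℚ.≟ 0ℚ
  ... | yes q≡0 = contradiction q≡0 q≢0
  ... | no  q≢0′ = begin
    p * ℚ.1/ q * q   ≡⟨ ℚ.*-assoc p (ℚ.1/ q) q ⟩
    p * (ℚ.1/ q * q) ≡⟨ cong (p *_) (ℚ.*-inverseˡ q) ⟩
    p * 1ℚ           ≡⟨ ℚ.*-identityʳ p ⟩
    p                ∎
    where instance _ = ℚ.≢-nonZero q≢0′

  ∣x^ℚn∣≡∣x∣^ℚn : ∀ x n → ∣ x ^ℚ n ∣ ≡ ∣ x ∣ ^ℚ n
  ∣x^ℚn∣≡∣x∣^ℚn x zero    = refl
  ∣x^ℚn∣≡∣x∣^ℚn x (suc n) = trans (ℚ.∣p*q∣≡∣p∣*∣q∣ x (x ^ℚ n)) (cong (∣ x ∣ *_) (∣x^ℚn∣≡∣x∣^ℚn x n))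

  ^ℚ-nonNeg : ∀ y n → .{{NonNegative y}} → NonNegative (y ^ℚ n)
  ^ℚ-nonNeg y zero    = _
  ^ℚ-nonNeg y (suc n) = ℚ.nonNeg*nonNeg⇒nonNeg y (y ^ℚ n) {{^ℚ-nonNeg y n}}

  sumℚ-nonNeg : ∀ n g → (∀ i → NonNegative (g i)) → NonNegative (sumℚ n g)
  sumℚ-nonNeg zero    g g≥0 = _
  sumℚ-nonNeg (suc n) g g≥0 = ℚ.nonNeg+nonNeg⇒nonNeg (sumℚ n g) {{sumℚ-nonNeg n g g≥0}} (g n) {{g≥0 n}}

  geometric-sum-pos : ∀ y n → .{{NonNegative y}} → Positive (sumℚ (suc n) (y ^ℚ_))
  geometric-sum-pos y n = subst Positive (sym (sumℚ-suc n (y ^ℚ_)))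
    (ℚ.pos+nonNeg⇒pos 1ℚ (sumℚ n (y ^ℚ_ ∘ suc))
      {{sumℚ-nonNeg n (y ^ℚ_ ∘ suc) (λ i → ^ℚ-nonNeg y (suc i))}})

  -- 1 - yⁿ factors as (1 - y)(1 + y + ⋯ + yⁿ⁻¹), and for y = ∣x∣ ≥ 0 the second factor is positive.
  1-^ℚ≢0 : ∀ x n → x ≢ 1ℚ → x ≢ - 1ℚ → 1 ℕ.≤ n → 1ℚ - x ^ℚ n ≢ 0ℚ
  1-^ℚ≢0 x (suc n) x≢1 x≢-1 _ 1-xⁿ≡0 =
    [ (λ ∣x∣≡x → x≢1 (trans (sym ∣x∣≡x) ∣x∣≡1))
    , (λ ∣x∣≡-x → x≢-1 (trans (sym (⁻¹-involutive x)) (cong -_ (trans (sym ∣x∣≡-x) ∣x∣≡1))))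
    ] (ℚ.∣p∣≡p∨∣p∣≡-p x)
    where
    instance _ = ℚ.∣-∣-nonNeg x
    S = sumℚ (suc n) (∣ x ∣ ^ℚ_)
    S≢0 : S ≢ 0ℚ
    S≢0 S≡0 = ℚ.<⇒≢ (ℚ.positive⁻¹ S {{geometric-sum-pos ∣ x ∣ n}}) (sym S≡0)
    ∣x∣ⁿ≡1 : ∣ x ∣ ^ℚ suc n ≡ 1ℚ
    ∣x∣ⁿ≡1 = trans (sym (∣x^ℚn∣≡∣x∣^ℚn x (suc n))) (cong ∣_∣ (sym (x∙y⁻¹≈ε⇒x≈y 1ℚ _ 1-xⁿ≡0)))
    1-∣x∣≡0 : 1ℚ - ∣ x ∣ ≡ 0ℚ
    1-∣x∣≡0 = *-cancelʳ-≡ (1ℚ - ∣ x ∣) 0ℚ S S≢0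
      (trans (geometric-sum ∣ x ∣ (suc n)) (trans (cong (λ p → 1ℚ - p) ∣x∣ⁿ≡1) (sym (ℚ.*-zeroˡ S))))
    ∣x∣≡1 : ∣ x ∣ ≡ 1ℚ
    ∣x∣≡1 = sym (x∙y⁻¹≈ε⇒x≈y 1ℚ ∣ x ∣ 1-∣x∣≡0)

module ModularArithmetic where

  open import Data.Nat.Base as ℕ using (ℕ; suc; _+_; _*_; _∸_; _≤_; _%_; _/_; NonZero)
  import Data.Nat.Properties as ℕ
  open import Data.Nat.DivMod
  open import Data.Nat.Divisibility using (_∣_; divides; ∣m⇒∣m*n)
  open import Data.Nat.Coprimality using (Coprime; coprime-factors; coprime-Bézout)
  open import Data.Nat.GCD using (module Bézout)
  open import Data.Nat.Tactic.RingSolver using (solve-∀)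
  open import Data.Integer.Base as ℤ using (+_)
  import Data.Integer.Properties as ℤ
  open import Data.Product.Base using (∃; _,_)
  open import Data.Sum.Base using (inj₁; inj₂)
  open import Relation.Binary.PropositionalEquality
  open ≡-Reasoning

  coprime-*ˡ : ∀ {m n d} → Coprime m d → Coprime n d → Coprime (m * n) d
  coprime-*ˡ {n = n} m⊥d n⊥d (i∣mn , i∣d) = n⊥d (coprime-factors m⊥d (i∣mn , ∣m⇒∣m*n n i∣d) , i∣d)

  ∣+m-+n∣≡m∸n : ∀ {m n} → n ≤ m → ℤ.∣ + m ℤ.- + n ∣ ≡ m ∸ n
  ∣+m-+n∣≡m∸n {m} {n} n≤m =
    trans (cong ℤ.∣_∣ (ℤ.m-n≡m⊖n m n)) (trans (ℤ.∣m⊖n∣≡∣n⊖m∣ m n) (ℤ.∣⊖∣-≤ n≤m))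

  ∣+m-+n∣≡n∸m : ∀ {m n} → m ≤ n → ℤ.∣ + m ℤ.- + n ∣ ≡ n ∸ m
  ∣+m-+n∣≡n∸m {m} {n} m≤n = trans (cong ℤ.∣_∣ (ℤ.m-n≡m⊖n m n)) (ℤ.∣⊖∣-≤ m≤n)

  module _ (c : ℕ) .{{_ : NonZero c}} where

    ∣∸⇒%≡ : ∀ {m n} → n ≤ m → c ∣ m ∸ n → m % c ≡ n % c
    ∣∸⇒%≡ {m} {n} n≤m c∣m∸n = trans (cong (_% c) (sym (ℕ.m+[n∸m]≡n n≤m))) (%-remove-+ʳ n c∣m∸n)

    %≡⇒∣∸ : ∀ m n → m % c ≡ n % c → c ∣ m ∸ n
    %≡⇒∣∸ m n m%c≡n%c = divides (m / c ∸ n / c) (begin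
      m ∸ n                                     ≡⟨ cong₂ _∸_ (m≡m%n+[m/n]*n m c) (m≡m%n+[m/n]*n n c) ⟩
      (m % c + m / c * c) ∸ (n % c + n / c * c) ≡⟨ cong (λ r → (r + m / c * c) ∸ (n % c + n / c * c)) m%c≡n%c ⟩
      (n % c + m / c * c) ∸ (n % c + n / c * c) ≡⟨ ℕ.[m+n]∸[m+o]≡n∸o (n % c) _ _ ⟩
      m / c * c ∸ n / c * c                     ≡⟨ ℕ.*-distribʳ-∸ c (m / c) (n / c) ⟨
      (m / c ∸ n / c) * c                       ∎)

    ≡[mod]⇒%≡ : ∀ m n → m ≡ n [mod c ] → m % c ≡ n % c
    ≡[mod]⇒%≡ m n c∣m-n with ℕ.≤-total n m
    ... | inj₁ n≤m = ∣∸⇒%≡ n≤m (subst (c ∣_) (∣+m-+n∣≡m∸n n≤m) c∣m-n)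
    ... | inj₂ m≤n = sym (∣∸⇒%≡ m≤n (subst (c ∣_) (∣+m-+n∣≡n∸m m≤n) c∣m-n))

    %≡⇒≡[mod] : ∀ m n → m % c ≡ n % c → m ≡ n [mod c ]
    %≡⇒≡[mod] m n m%c≡n%c with ℕ.≤-total n m
    ... | inj₁ n≤m = subst (c ∣_) (sym (∣+m-+n∣≡m∸n n≤m)) (%≡⇒∣∸ m n m%c≡n%c)
    ... | inj₂ m≤n = subst (c ∣_) (sym (∣+m-+n∣≡n∸m m≤n)) (%≡⇒∣∸ n m (sym m%c≡n%c))

    *-%-absorbʳ : ∀ m n → m * (n % c) % c ≡ m * n % c
    *-%-absorbʳ m n = begin
      m * (n % c) % c             ≡⟨ %-distribˡ-* m (n % c) c ⟩
      m % c * (n % c % c) % c     ≡⟨ cong (λ k → m % c * k % c) (m%n%n≡m%n n c) ⟩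
      m % c * (n % c) % c         ≡⟨ %-distribˡ-* m n c ⟨
      m * n % c                   ∎

    *-%-absorbˡ : ∀ m n → m % c * n % c ≡ m * n % c
    *-%-absorbˡ m n = begin
      m % c * n % c   ≡⟨ cong (_% c) (ℕ.*-comm (m % c) n) ⟩
      n * (m % c) % c ≡⟨ *-%-absorbʳ n m ⟩
      n * m % c       ≡⟨ cong (_% c) (ℕ.*-comm n m) ⟩
      m * n % c       ∎

    inverse-%-cancel : ∀ u v → u * v % c ≡ 1 % c → ∀ n → u * (v * n % c) % c ≡ n % c
    inverse-%-cancel u v uv≡1 n = begin
      u * (v * n % c) % c   ≡⟨ *-%-absorbʳ u (v * n) ⟩
      u * (v * n) % c       ≡⟨ cong (_% c) (ℕ.*-assoc u v n) ⟨
      u * v * n % c         ≡⟨ *-%-absorbˡ (u * v) n ⟨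
      u * v % c * n % c     ≡⟨ cong (λ k → k * n % c) uv≡1 ⟩
      1 % c * n % c         ≡⟨ *-%-absorbˡ 1 n ⟩
      1 * n % c             ≡⟨ cong (_% c) (ℕ.*-identityˡ n) ⟩
      n % c                 ∎

  inverse-mod : ∀ d C .{{_ : NonZero C}} → Coprime d C → ∃ λ e → e * d % C ≡ 1 % C
  inverse-mod d (suc C) d⊥C with coprime-Bézout d⊥C
  ... | Bézout.+- x y 1+yC≡xd = x , (begin
    x * d % suc C               ≡⟨ cong (_% suc C) 1+yC≡xd ⟨
    (1 + y * suc C) % suc C     ≡⟨ [m+kn]%n≡m%n 1 y (suc C) ⟩
    1 % suc C                   ∎)
  ... | Bézout.-+ x y 1+xd≡yC = x * C , (begin
    x * C * d % suc C                       ≡⟨ [m+kn]%n≡m%n (x * C * d) y (suc C) ⟨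
    (x * C * d + y * suc C) % suc C         ≡⟨ cong (λ k → (x * C * d + k) % suc C) 1+xd≡yC ⟨
    (x * C * d + (1 + x * d)) % suc C       ≡⟨ cong (_% suc C) (regroup x C d) ⟩
    (1 + x * d * suc C) % suc C             ≡⟨ [m+kn]%n≡m%n 1 (x * d) (suc C) ⟩
    1 % suc C                               ∎)
    where
    -- Here −x inverts d, and −x ≡ x C (mod C + 1).
    regroup : ∀ x C d → x * C * d + (1 + x * d) ≡ 1 + x * d * suc C
    regroup = solve-∀

module ApérySet where

  open import Data.Nat.Base as ℕ
    using (ℕ; suc; _+_; _*_; _∸_; _≤_; _<_; _%_; _/_; _⊔_; NonZero; >-nonZero; s≤s; z≤n)
  import Data.Nat.Properties as ℕ
  open import Data.Nat.DivMod
  open import Data.Nat.Divisibility using (divides; n∣m*n; m∣m*n)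
  open import Data.Nat.GCD using (gcd)
  open import Data.Nat.Coprimality as Coprimality using (Coprime; gcd≡1⇒coprime)
  open import Data.Nat.Tactic.RingSolver using (solve-∀)
  open import Data.List.Base using (List; []; _∷_)
  open import Data.Product.Base using (∃; ∃₂; _,_; proj₁; proj₂)
  open import Data.Sum.Base using (inj₁; inj₂)
  open import Relation.Binary.PropositionalEquality
  open ModularArithmetic

  IsN-unique : ∀ {c bs r M N} → IsN c bs r M → IsN c bs r N → M ≡ N
  IsN-unique ((M≡r , repM) , M-min) ((N≡r , repN) , N-min) =
    ℕ.≤-antisym (M-min _ N≡r repN) (N-min _ M≡r repM)

  Rep₃⁺ : ∀ u v w x y z → Rep (u ∷ v ∷ w ∷ []) (u * x + (v * y + (w * z + 0)))
  Rep₃⁺ u v w x y z = x , _ , (y , _ , (z , 0 , refl , refl) , refl) , refl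

  Rep₃⁻ : ∀ u v w {n} → Rep (u ∷ v ∷ w ∷ []) n →
          ∃₂ λ x y → ∃ λ z → n ≡ u * x + (v * y + (w * z + 0))
  Rep₃⁻ u v w (x , _ , (y , _ , (z , _ , refl , refl) , refl) , refl) = x , y , z , refl

  generator-weight : ∀ h a d x y z →
    (h * (a * a) + d) * x + ((h * (a * a) + a * d) * y + ((h * (a * a) + (a + 1) * d) * z + 0))
    ≡ (x + y + z) * (h * (a * a)) + (a * (y + z) + (x + z)) * d
  generator-weight = solve-∀

  digits-≤ : ∀ {a t p q s} .{{_ : NonZero a}} .{{_ : NonZero (a * a)}} →
             t < a * a → (a * p + q) % (a * a) ≡ t → p ≤ s → q ≤ s → t / a ⊔ t % a ≤ s
  digits-≤ {a} {t} {p} {q} {s} t<aa t′%aa≡t p≤s q≤s = ℕ.⊔-lub t/a≤s t%a≤s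
    where
    open ℕ.≤-Reasoning
    t≤t′ : t ≤ a * p + q
    t≤t′ = subst (_≤ a * p + q) t′%aa≡t (m%n≤m (a * p + q) (a * a))
    t%a≤s : t % a ≤ s
    t%a≤s = begin
      t % a                     ≡⟨ cong (_% a) t′%aa≡t ⟨
      (a * p + q) % (a * a) % a ≡⟨ m∣n⇒o%n%m≡o%m a (a * a) (a * p + q) (m∣m*n a) ⟩
      (a * p + q) % a           ≡⟨ %-remove-+ˡ q (m∣m*n p) ⟩
      q % a                     ≤⟨ m%n≤m q a ⟩
      q                         ≤⟨ q≤s ⟩
      s                         ∎
    a≤s : s < t / a → a ≤ s
    a≤s s<t/a = ℕ.+-cancelˡ-≤ (s * a) a s (begin
      s * a + a  ≡⟨ ℕ.+-comm (s * a) a ⟩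
      suc s * a  ≤⟨ ℕ.*-monoˡ-≤ a s<t/a ⟩
      t / a * a  ≤⟨ m/n*n≤m t a ⟩
      t          ≤⟨ t≤t′ ⟩
      a * p + q  ≤⟨ ℕ.+-mono-≤ (ℕ.*-monoʳ-≤ a p≤s) q≤s ⟩
      a * s + s  ≡⟨ cong (_+ s) (ℕ.*-comm a s) ⟩
      s * a + s  ∎)
    t/a≤s : t / a ≤ s
    t/a≤s = ℕ.≮⇒≥ λ s<t/a → ℕ.<-irrefl refl
      (ℕ.<-≤-trans (ℕ.<-trans s<t/a (m<n*o⇒m/o<n {t} {a} {a} t<aa)) (a≤s s<t/a))

  module Apéry (a h d : ℕ) (1<a : 1 < a) (gcd[a,d]≡1 : gcd a d ≡ 1) where

    c : ℕ
    c = a * a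

    b₁ b₂ b₃ : ℕ
    b₁ = h * (a * a) + d
    b₂ = h * (a * a) + a * d
    b₃ = h * (a * a) + (a + 1) * d

    generators : List ℕ
    generators = b₁ ∷ b₂ ∷ b₃ ∷ []

    instance
      a≢0 : NonZero a
      a≢0 = >-nonZero (ℕ.<-trans (s≤s z≤n) 1<a)
      c≢0 : NonZero c
      c≢0 = ℕ.m*n≢0 a a

    weighted : ℕ → ℕ → ℕ
    weighted s t = s * (h * c) + t * d

    Rep-weighted⁺ : ∀ x y z → Rep generators (weighted (x + y + z) (a * (y + z) + (x + z)))
    Rep-weighted⁺ x y z = subst (Rep generators) (generator-weight h a d x y z) (Rep₃⁺ b₁ b₂ b₃ x y z)

    Rep-weighted⁻ : ∀ {n} → Rep generators n →
                    ∃₂ λ x y → ∃ λ z → n ≡ weighted (x + y + z) (a * (y + z) + (x + z))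
    Rep-weighted⁻ rep with Rep₃⁻ b₁ b₂ b₃ rep
    ... | x , y , z , n≡ = x , y , z , trans n≡ (generator-weight h a d x y z)

    weighted-mono : ∀ {s s′ t t′} → s ≤ s′ → t ≤ t′ → weighted s t ≤ weighted s′ t′
    weighted-mono s≤s′ t≤t′ = ℕ.+-mono-≤ (ℕ.*-monoˡ-≤ (h * c) s≤s′) (ℕ.*-monoˡ-≤ d t≤t′)

    d⊥c : Coprime d c
    d⊥c = Coprimality.sym (coprime-*ˡ a⊥d a⊥d)
      where
      a⊥d : Coprime a d
      a⊥d = gcd≡1⇒coprime gcd[a,d]≡1

    e : ℕ
    e = proj₁ (inverse-mod d c d⊥c)

    e*d≡1 : e * d % c ≡ 1 % c
    e*d≡1 = proj₂ (inverse-mod d c d⊥c)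

    toResidue fromResidue : ℕ → ℕ
    toResidue t = d * t % c
    fromResidue r = e * r % c

    toResidue-fromResidue : ∀ r → r < c → toResidue (fromResidue r) ≡ r
    toResidue-fromResidue r r<c =
      trans (inverse-%-cancel c d e (trans (cong (_% c) (ℕ.*-comm d e)) e*d≡1) r) (m<n⇒m%n≡m r<c)

    fromResidue-toResidue : ∀ t → t < c → fromResidue (toResidue t) ≡ t
    fromResidue-toResidue t t<c = trans (inverse-%-cancel c e d e*d≡1 t) (m<n⇒m%n≡m t<c)

    weighted-% : ∀ s t → weighted s t % c ≡ toResidue t
    weighted-% s t =
      trans (%-remove-+ˡ (t * d) (divides (s * h) (sym (ℕ.*-assoc s h c)))) (cong (_% c) (ℕ.*-comm t d))

    apéry : ℕ → ℕ
    apéry t = weighted (t / a ⊔ t % a) t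

    Rep-digits : ∀ k j → Rep generators (weighted (k ⊔ j) (k * a + j))
    Rep-digits k j with ℕ.≤-total k j
    ... | inj₁ k≤j = subst (Rep generators)
      (cong₂ weighted
        (trans (cong (_+ k) (ℕ.+-identityʳ (j ∸ k))) (trans (ℕ.m∸n+n≡m k≤j) (sym (ℕ.m≤n⇒m⊔n≡n k≤j))))
        (cong₂ _+_ (ℕ.*-comm a k) (ℕ.m∸n+n≡m k≤j)))
      (Rep-weighted⁺ (j ∸ k) 0 k)
    ... | inj₂ j≤k = subst (Rep generators)
      (cong₂ weighted
        (trans (ℕ.m∸n+n≡m j≤k) (sym (ℕ.m≥n⇒m⊔n≡m j≤k)))
        (cong (_+ j) (trans (cong (a *_) (ℕ.m∸n+n≡m j≤k)) (ℕ.*-comm a k))))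
      (Rep-weighted⁺ 0 (k ∸ j) j)

    apéry-digits : ∀ k j → j < a → apéry (k * a + j) ≡ weighted (k ⊔ j) (k * a + j)
    apéry-digits k j j<a = cong₂ (λ q r → weighted (q ⊔ r) (k * a + j)) quotient remainder
      where
      quotient : (k * a + j) / a ≡ k
      quotient = trans (+-distrib-/-∣ˡ j (n∣m*n k))
                       (trans (cong₂ _+_ (m*n/n≡m k a) (m<n⇒m/n≡0 j<a)) (ℕ.+-identityʳ k))
      remainder : (k * a + j) % a ≡ j
      remainder = trans (%-remove-+ˡ j (n∣m*n k)) (m<n⇒m%n≡m j<a)

    apéry-Rep : ∀ t → Rep generators (apéry t)
    apéry-Rep t = subst (λ t′ → Rep generators (weighted (t / a ⊔ t % a) t′))
      (trans (ℕ.+-comm (t / a * a) (t % a)) (sym (m≡m%n+[m/n]*n t a)))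
      (Rep-digits (t / a) (t % a))

    apéry-minimal : ∀ t → t < c → ∀ {n} → Rep generators n → n % c ≡ toResidue t → apéry t ≤ n
    apéry-minimal t t<c rep n%c≡ with Rep-weighted⁻ rep
    ... | x , y , z , refl = weighted-mono
      (digits-≤ t<c t′%c≡t (ℕ.+-monoˡ-≤ z (ℕ.m≤n+m y x)) (ℕ.+-monoˡ-≤ z (ℕ.m≤m+n x y)))
      (subst (_≤ t′) t′%c≡t (m%n≤m t′ c))
      where
      open ≡-Reasoning
      t′ = a * (y + z) + (x + z)
      t′%c≡t : t′ % c ≡ t
      t′%c≡t = begin
        t′ % c                     ≡⟨ inverse-%-cancel c e d e*d≡1 t′ ⟨
        fromResidue (toResidue t′) ≡⟨ cong fromResidue (trans (sym (weighted-% (x + y + z) t′)) n%c≡) ⟩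
        fromResidue (toResidue t)  ≡⟨ fromResidue-toResidue t t<c ⟩
        t                          ∎

    IsN-apéry : ∀ r → r < c → IsN c generators r (apéry (fromResidue r))
    IsN-apéry r r<c =
      (%≡⇒≡[mod] c (apéry t) r apéry%c≡r%c , apéry-Rep t) ,
      λ n n≡r rep → apéry-minimal t (m%n<n (e * r) c) rep (trans (≡[mod]⇒%≡ c n r n≡r) (sym residue≡r%c))
      where
      t = fromResidue r
      residue≡r%c : toResidue t ≡ r % c
      residue≡r%c = trans (toResidue-fromResidue r r<c) (sym (m<n⇒m%n≡m r<c))
      apéry%c≡r%c : apéry t % c ≡ r % c
      apéry%c≡r%c = trans (weighted-% (t / a ⊔ t % a) t) residue≡r%c

module TriangleSums (a h d : ℕ) (x : ℚ) where

  open import Data.Nat.Base as ℕ using (suc; _∸_; _≤_)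
  import Data.Nat.Properties as ℕ
  open import Data.Nat.Tactic.RingSolver using (solve-∀)
  open import Data.Rational.Base using (1ℚ; 0ℚ; _+_; _*_; _-_; -_)
  import Data.Rational.Properties as ℚ
  open import Data.Rational.Solver using (module +-*-Solver)
  open +-*-Solver using (solve; _:=_; _:+_; _:*_; _:-_; con; Polynomial)
  open import Relation.Binary.PropositionalEquality
  open ≡-Reasoning
  open RationalAlgebra

  upper lower : ℚ
  upper = sumℚ a (λ m → sumℚ (a ∸ m) (λ i →
            x ^ℚ ((m ℕ.+ i) ℕ.* h ℕ.* (a ℕ.* a) ℕ.+ (m ℕ.* (a ℕ.+ 1) ℕ.+ i) ℕ.* d)))
  lower = sumℚ (a ∸ 1) (λ m → sumℚ (suc m) (λ i →
            x ^ℚ ((m ℕ.+ 1) ℕ.* h ℕ.* (a ℕ.* a) ℕ.+ ((m ℕ.+ 1) ℕ.* a ℕ.+ i) ℕ.* d)))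

  u v w : ℕ
  u = h ℕ.* (a ℕ.* a) ℕ.+ d
  v = h ℕ.* (a ℕ.* a) ℕ.+ a ℕ.* d
  w = h ℕ.* (a ℕ.* a) ℕ.+ a ℕ.* d ℕ.+ d

  1-x^ : ℕ → ℚ
  1-x^ k = 1ℚ - x ^ℚ k

  T₁ T₂ T₃ T₄ : ℚ
  T₁ = (x ^ℚ (a ℕ.* w) - x ^ℚ (a ℕ.* u)) ÷′ (1-x^ (a ℕ.* d) * 1-x^ u)
  T₂ = (1ℚ - x ^ℚ (a ℕ.* w)) ÷′ (1-x^ u * 1-x^ w)
  T₃ = (x ^ℚ (a ℕ.* w) - x ^ℚ w) ÷′ (1-x^ w * 1-x^ d)
  T₄ = (x ^ℚ v - x ^ℚ ((a ℕ.* a) ℕ.* (h ℕ.* a ℕ.+ d))) ÷′ (1-x^ v * 1-x^ d)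

  U V W P Q Uᵃ Vᵃ Wᵃ : ℚ
  U = x ^ℚ u
  V = x ^ℚ v
  W = x ^ℚ w
  P = x ^ℚ (a ℕ.* d)
  Q = x ^ℚ d
  Uᵃ = x ^ℚ (a ℕ.* u)
  Vᵃ = x ^ℚ ((a ℕ.* a) ℕ.* (h ℕ.* a ℕ.+ d))
  Wᵃ = x ^ℚ (a ℕ.* w)

  W≡U*P : W ≡ U * P
  W≡U*P = trans (cong (x ^ℚ_) (w≡u+ad h a d)) (^ℚ-distribˡ-+-* x u (a ℕ.* d))
    where
    w≡u+ad : ∀ h a d → h ℕ.* (a ℕ.* a) ℕ.+ a ℕ.* d ℕ.+ d ≡ h ℕ.* (a ℕ.* a) ℕ.+ d ℕ.+ a ℕ.* d
    w≡u+ad = solve-∀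

  W≡V*Q : W ≡ V * Q
  W≡V*Q = ^ℚ-distribˡ-+-* x v d

  Vᵃ≡V^a : Vᵃ ≡ V ^ℚ a
  Vᵃ≡V^a = trans (cong (x ^ℚ_) (a²[ha+d]≡a*v h a d)) (sym (^ℚ-*-assoc x a v))
    where
    a²[ha+d]≡a*v : ∀ h a d → (a ℕ.* a) ℕ.* (h ℕ.* a ℕ.+ d) ≡ a ℕ.* (h ℕ.* (a ℕ.* a) ℕ.+ a ℕ.* d)
    a²[ha+d]≡a*v = solve-∀

  Uᵃ*Pᵃ≡Wᵃ : Uᵃ * P ^ℚ a ≡ Wᵃ
  Uᵃ*Pᵃ≡Wᵃ = begin
    Uᵃ * P ^ℚ a      ≡⟨ cong (_* P ^ℚ a) (^ℚ-*-assoc x a u) ⟨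
    U ^ℚ a * P ^ℚ a  ≡⟨ ^ℚ-distribʳ-* U P a ⟨
    (U * P) ^ℚ a     ≡⟨ cong (_^ℚ a) W≡U*P ⟨
    W ^ℚ a           ≡⟨ ^ℚ-*-assoc x a w ⟩
    Wᵃ               ∎

  upper-factored : upper ≡ sumℚ a (λ m → W ^ℚ m * sumℚ (a ∸ m) (U ^ℚ_))
  upper-factored = sumℚ-cong a λ m _ →
    trans (sumℚ-cong (a ∸ m) λ i _ → trans (cong (x ^ℚ_) (exponent h a d m i)) (^ℚ-+-* x m w i u))
          (sym (*-distribˡ-sumℚ (a ∸ m) (W ^ℚ m) (U ^ℚ_)))
    where
    exponent : ∀ h a d m i → (m ℕ.+ i) ℕ.* h ℕ.* (a ℕ.* a) ℕ.+ (m ℕ.* (a ℕ.+ 1) ℕ.+ i) ℕ.* d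
                           ≡ m ℕ.* (h ℕ.* (a ℕ.* a) ℕ.+ a ℕ.* d ℕ.+ d) ℕ.+ i ℕ.* (h ℕ.* (a ℕ.* a) ℕ.+ d)
    exponent = solve-∀

  lower-factored : lower ≡ sumℚ (a ∸ 1) (λ m → V ^ℚ suc m * sumℚ (suc m) (Q ^ℚ_))
  lower-factored = sumℚ-cong (a ∸ 1) λ m _ →
    trans (sumℚ-cong (suc m) λ i _ → trans (cong (x ^ℚ_) (exponent h a d m i)) (^ℚ-+-* x (suc m) v i d))
          (sym (*-distribˡ-sumℚ (suc m) (V ^ℚ suc m) (Q ^ℚ_)))
    where
    exponent : ∀ h a d m i → (m ℕ.+ 1) ℕ.* h ℕ.* (a ℕ.* a) ℕ.+ ((m ℕ.+ 1) ℕ.* a ℕ.+ i) ℕ.* d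
                           ≡ suc m ℕ.* (h ℕ.* (a ℕ.* a) ℕ.+ a ℕ.* d) ℕ.+ i ℕ.* d
    exponent = solve-∀

  upper-telescoped : (1ℚ - U) * upper ≡ sumℚ a (W ^ℚ_) - Uᵃ * sumℚ a (P ^ℚ_)
  upper-telescoped = begin
    (1ℚ - U) * upper
      ≡⟨ cong ((1ℚ - U) *_) upper-factored ⟩
    (1ℚ - U) * sumℚ a (λ m → W ^ℚ m * sumℚ (a ∸ m) (U ^ℚ_))
      ≡⟨ weighted-geometric-sum U a (W ^ℚ_) (a ∸_) ⟩
    sumℚ a (W ^ℚ_) - sumℚ a (λ m → W ^ℚ m * U ^ℚ (a ∸ m))
      ≡⟨ cong (λ q → sumℚ a (W ^ℚ_) - q) (sumℚ-cong a term) ⟩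
    sumℚ a (W ^ℚ_) - sumℚ a (λ m → Uᵃ * P ^ℚ m)
      ≡⟨ cong (λ q → sumℚ a (W ^ℚ_) - q) (*-distribˡ-sumℚ a Uᵃ (P ^ℚ_)) ⟨
    sumℚ a (W ^ℚ_) - Uᵃ * sumℚ a (P ^ℚ_) ∎
    where
    term : ∀ m → m ℕ.< a → W ^ℚ m * U ^ℚ (a ∸ m) ≡ Uᵃ * P ^ℚ m
    term m m<a = begin
      W ^ℚ m * U ^ℚ (a ∸ m)              ≡⟨ cong (λ q → q ^ℚ m * U ^ℚ (a ∸ m)) W≡U*P ⟩
      (U * P) ^ℚ m * U ^ℚ (a ∸ m)        ≡⟨ cong (_* U ^ℚ (a ∸ m)) (^ℚ-distribʳ-* U P m) ⟩
      U ^ℚ m * P ^ℚ m * U ^ℚ (a ∸ m)     ≡⟨ solve 3 (λ p q r → p :* q :* r := p :* r :* q)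
                                                  refl (U ^ℚ m) (P ^ℚ m) (U ^ℚ (a ∸ m)) ⟩
      U ^ℚ m * U ^ℚ (a ∸ m) * P ^ℚ m     ≡⟨ cong (_* P ^ℚ m) (^ℚ-distribˡ-+-* U m (a ∸ m)) ⟨
      U ^ℚ (m ℕ.+ (a ∸ m)) * P ^ℚ m      ≡⟨ cong (λ k → U ^ℚ k * P ^ℚ m) (ℕ.m+[n∸m]≡n (ℕ.<⇒≤ m<a)) ⟩
      U ^ℚ a * P ^ℚ m                    ≡⟨ cong (_* P ^ℚ m) (^ℚ-*-assoc x a u) ⟩
      Uᵃ * P ^ℚ m                        ∎

  lower-telescoped : (1ℚ - Q) * lower ≡ sumℚ (a ∸ 1) (λ m → V ^ℚ suc m) - sumℚ (a ∸ 1) (λ m → W ^ℚ suc m)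
  lower-telescoped = begin
    (1ℚ - Q) * lower
      ≡⟨ cong ((1ℚ - Q) *_) lower-factored ⟩
    (1ℚ - Q) * sumℚ (a ∸ 1) (λ m → V ^ℚ suc m * sumℚ (suc m) (Q ^ℚ_))
      ≡⟨ weighted-geometric-sum Q (a ∸ 1) (λ m → V ^ℚ suc m) suc ⟩
    SV - sumℚ (a ∸ 1) (λ m → V ^ℚ suc m * Q ^ℚ suc m)
      ≡⟨ cong (λ q → SV - q) (sumℚ-cong (a ∸ 1) λ m _ →
           trans (sym (^ℚ-distribʳ-* V Q (suc m))) (cong (_^ℚ suc m) (sym W≡V*Q))) ⟩
    SV - sumℚ (a ∸ 1) (λ m → W ^ℚ suc m) ∎
    where
    SV = sumℚ (a ∸ 1) (λ m → V ^ℚ suc m)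

  module _ (1≤a : 1 ≤ a) (1≤d : 1 ≤ d) (x≢1 : x ≢ 1ℚ) (x≢-1 : x ≢ - 1ℚ) where

    1-x^≢0 : ∀ k → 1 ≤ k → 1-x^ k ≢ 0ℚ
    1-x^≢0 k = 1-^ℚ≢0 x k x≢1 x≢-1

    1≤u : 1 ≤ u
    1≤u = ℕ.≤-trans 1≤d (ℕ.m≤n+m d _)
    1≤ad : 1 ≤ a ℕ.* d
    1≤ad = ℕ.*-mono-≤ 1≤a 1≤d
    1≤v : 1 ≤ v
    1≤v = ℕ.≤-trans 1≤ad (ℕ.m≤n+m (a ℕ.* d) _)
    1≤w : 1 ≤ w
    1≤w = ℕ.≤-trans 1≤d (ℕ.m≤n+m d _)

    1:-_ : ∀ {n} → Polynomial n → Polynomial n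
    1:- p = con 1ℚ :- p

    upper≡T₁+T₂ : upper ≡ T₁ + T₂
    upper≡T₁+T₂ = *-cancelʳ-≡ upper (T₁ + T₂) D D≢0 (begin
      upper * D
        ≡⟨ solve 4 (λ s P U W → s :* ((1:- P) :* (1:- U) :* (1:- W))
                                := (1:- P) :* (1:- W) :* ((1:- U) :* s))
                 refl upper P U W ⟩
      (1ℚ - P) * (1ℚ - W) * ((1ℚ - U) * upper)
        ≡⟨ cong ((1ℚ - P) * (1ℚ - W) *_) upper-telescoped ⟩
      (1ℚ - P) * (1ℚ - W) * (GW - Uᵃ * GP)
        ≡⟨ solve 5 (λ P W g Uᵃ q → (1:- P) :* (1:- W) :* (g :- Uᵃ :* q)
                                  := (1:- P) :* ((1:- W) :* g) :- Uᵃ :* (1:- W) :* ((1:- P) :* q))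
                 refl P W GW Uᵃ GP ⟩
      (1ℚ - P) * ((1ℚ - W) * GW) - Uᵃ * (1ℚ - W) * ((1ℚ - P) * GP)
        ≡⟨ cong₂ (λ g q → (1ℚ - P) * g - Uᵃ * (1ℚ - W) * q)
                 (trans (geometric-sum W a) (cong (λ q → 1ℚ - q) (^ℚ-*-assoc x a w))) (geometric-sum P a) ⟩
      (1ℚ - P) * (1ℚ - Wᵃ) - Uᵃ * (1ℚ - W) * (1ℚ - P ^ℚ a)
        ≡⟨ solve 5 (λ P W Wᵃ Uᵃ Pᵃ → (1:- P) :* (1:- Wᵃ) :- Uᵃ :* (1:- W) :* (1:- Pᵃ)
                                    := (1:- W) :* (Uᵃ :* Pᵃ :- Uᵃ) :+ (1:- P) :* (1:- Wᵃ))
                 refl P W Wᵃ Uᵃ (P ^ℚ a) ⟩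
      (1ℚ - W) * (Uᵃ * P ^ℚ a - Uᵃ) + (1ℚ - P) * (1ℚ - Wᵃ)
        ≡⟨ cong (λ q → (1ℚ - W) * (q - Uᵃ) + (1ℚ - P) * (1ℚ - Wᵃ)) Uᵃ*Pᵃ≡Wᵃ ⟩
      (1ℚ - W) * (Wᵃ - Uᵃ) + (1ℚ - P) * (1ℚ - Wᵃ)
        ≡⟨ cong₂ (λ p q → (1ℚ - W) * p + (1ℚ - P) * q)
                 (sym (÷′-*-cancel _ _ (*-≢0 (1-x^≢0 (a ℕ.* d) 1≤ad) (1-x^≢0 u 1≤u))))
                 (sym (÷′-*-cancel _ _ (*-≢0 (1-x^≢0 u 1≤u) (1-x^≢0 w 1≤w)))) ⟩
      (1ℚ - W) * (T₁ * ((1ℚ - P) * (1ℚ - U))) + (1ℚ - P) * (T₂ * ((1ℚ - U) * (1ℚ - W)))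
        ≡⟨ solve 5 (λ t₁ t₂ P U W → (1:- W) :* (t₁ :* ((1:- P) :* (1:- U))) :+ (1:- P) :* (t₂ :* ((1:- U) :* (1:- W)))
                                   := (t₁ :+ t₂) :* ((1:- P) :* (1:- U) :* (1:- W)))
                 refl T₁ T₂ P U W ⟩
      (T₁ + T₂) * D ∎)
      where
      D = (1ℚ - P) * (1ℚ - U) * (1ℚ - W)
      D≢0 : D ≢ 0ℚ
      D≢0 = *-≢0 (*-≢0 (1-x^≢0 (a ℕ.* d) 1≤ad) (1-x^≢0 u 1≤u)) (1-x^≢0 w 1≤w)
      GW = sumℚ a (W ^ℚ_)
      GP = sumℚ a (P ^ℚ_)

    lower≡T₃+T₄ : lower ≡ T₃ + T₄
    lower≡T₃+T₄ = *-cancelʳ-≡ lower (T₃ + T₄) D D≢0 (begin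
      lower * D
        ≡⟨ solve 4 (λ s Q V W → s :* ((1:- Q) :* (1:- V) :* (1:- W))
                                := (1:- V) :* (1:- W) :* ((1:- Q) :* s))
                 refl lower Q V W ⟩
      (1ℚ - V) * (1ℚ - W) * ((1ℚ - Q) * lower)
        ≡⟨ cong ((1ℚ - V) * (1ℚ - W) *_) lower-telescoped ⟩
      (1ℚ - V) * (1ℚ - W) * (SV - SW)
        ≡⟨ solve 4 (λ V W p q → (1:- V) :* (1:- W) :* (p :- q)
                                := (1:- W) :* ((1:- V) :* p) :- (1:- V) :* ((1:- W) :* q))
                 refl V W SV SW ⟩
      (1ℚ - W) * ((1ℚ - V) * SV) - (1ℚ - V) * ((1ℚ - W) * SW)
        ≡⟨ cong₂ (λ p q → (1ℚ - W) * p - (1ℚ - V) * q)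
                 (shifted-geometric-sum-to-a V Vᵃ (sym Vᵃ≡V^a))
                 (shifted-geometric-sum-to-a W Wᵃ (^ℚ-*-assoc x a w)) ⟩
      (1ℚ - W) * (V - Vᵃ) - (1ℚ - V) * (W - Wᵃ)
        ≡⟨ solve 4 (λ V W Vᵃ Wᵃ → (1:- W) :* (V :- Vᵃ) :- (1:- V) :* (W :- Wᵃ)
                                  := (1:- V) :* (Wᵃ :- W) :+ (1:- W) :* (V :- Vᵃ))
                 refl V W Vᵃ Wᵃ ⟩
      (1ℚ - V) * (Wᵃ - W) + (1ℚ - W) * (V - Vᵃ)
        ≡⟨ cong₂ (λ p q → (1ℚ - V) * p + (1ℚ - W) * q)
                 (sym (÷′-*-cancel _ _ (*-≢0 (1-x^≢0 w 1≤w) (1-x^≢0 d 1≤d))))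
                 (sym (÷′-*-cancel _ _ (*-≢0 (1-x^≢0 v 1≤v) (1-x^≢0 d 1≤d)))) ⟩
      (1ℚ - V) * (T₃ * ((1ℚ - W) * (1ℚ - Q))) + (1ℚ - W) * (T₄ * ((1ℚ - V) * (1ℚ - Q)))
        ≡⟨ solve 5 (λ t₃ t₄ Q V W → (1:- V) :* (t₃ :* ((1:- W) :* (1:- Q))) :+ (1:- W) :* (t₄ :* ((1:- V) :* (1:- Q)))
                                   := (t₃ :+ t₄) :* ((1:- Q) :* (1:- V) :* (1:- W)))
                 refl T₃ T₄ Q V W ⟩
      (T₃ + T₄) * D ∎)
      where
      D = (1ℚ - Q) * (1ℚ - V) * (1ℚ - W)
      D≢0 : D ≢ 0ℚ
      D≢0 = *-≢0 (*-≢0 (1-x^≢0 d 1≤d) (1-x^≢0 v 1≤v)) (1-x^≢0 w 1≤w)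
      SV = sumℚ (a ∸ 1) (λ m → V ^ℚ suc m)
      SW = sumℚ (a ∸ 1) (λ m → W ^ℚ suc m)
      shifted-geometric-sum-to-a : ∀ y yᵃ → y ^ℚ a ≡ yᵃ →
                                   (1ℚ - y) * sumℚ (a ∸ 1) (λ m → y ^ℚ suc m) ≡ y - yᵃ
      shifted-geometric-sum-to-a y yᵃ y^a≡yᵃ = trans (shifted-geometric-sum y (a ∸ 1))
        (cong (λ q → y - q) (trans (cong (y ^ℚ_) (ℕ.m+[n∸m]≡n 1≤a)) y^a≡yᵃ))

    closed-form : upper + lower ≡ T₁ + T₂ + T₃ + T₄
    closed-form = trans (cong₂ _+_ upper≡T₁+T₂ lower≡T₃+T₄) (sym (ℚ.+-assoc (T₁ + T₂) T₃ T₄))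

module ApéryGeneratingFunction (a h d : ℕ) (1<a : 1 < a) (gcd[a,d]≡1 : gcd a d ≡ 1) (x : ℚ) where

  open import Data.Nat.Base using (suc; _+_; _*_; _∸_; _⊔_)
  import Data.Nat.Properties as ℕ
  open import Data.Nat.DivMod using (m%n<n)
  open import Data.Nat.Tactic.RingSolver using (solve-∀)
  import Data.Rational.Base as ℚ
  import Data.Rational.Properties as ℚ
  open import Relation.Binary.PropositionalEquality
  open ≡-Reasoning
  open RationalAlgebra
  open ApérySet
  open ApérySet.Apéry a h d 1<a gcd[a,d]≡1
  open TriangleSums a h d x using (upper; lower)

  digit-term : ℕ → ℕ → ℚ
  digit-term k j = x ^ℚ weighted (k ⊔ j) (k * a + j)

  sumℚ-x^apéry : sumℚ c (λ t → x ^ℚ apéry t) ≡ sumℚ a (λ k → sumℚ a (digit-term k))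
  sumℚ-x^apéry = trans (sumℚ-* a a (λ t → x ^ℚ apéry t))
    (sumℚ-cong a λ k _ → sumℚ-cong a λ j j<a → cong (x ^ℚ_) (apéry-digits k j j<a))

  sumℚ-j≥k≡upper : sumℚ a (λ k → sumℚ (a ∸ k) (λ i → digit-term k (k + i))) ≡ upper
  sumℚ-j≥k≡upper = sumℚ-cong a λ k _ → sumℚ-cong (a ∸ k) λ i _ → cong (x ^ℚ_)
    (trans (cong (λ s → weighted s (k * a + (k + i))) (ℕ.m≤n⇒m⊔n≡n (ℕ.m≤m+n k i))) (exponent h a d k i))
    where
    exponent : ∀ h a d k i → (k + i) * (h * (a * a)) + (k * a + (k + i)) * d
                           ≡ (k + i) * h * (a * a) + (k * (a + 1) + i) * d
    exponent = solve-∀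

  sumℚ-j<k≡lower : sumℚ a (λ k → sumℚ k (digit-term k)) ≡ lower
  sumℚ-j<k≡lower = begin
    sumℚ a (λ k → sumℚ k (digit-term k))
      ≡⟨ cong (λ n → sumℚ n (λ k → sumℚ k (digit-term k))) (ℕ.m+[n∸m]≡n (ℕ.<⇒≤ 1<a)) ⟨
    sumℚ (suc (a ∸ 1)) (λ k → sumℚ k (digit-term k))
      ≡⟨ sumℚ-suc (a ∸ 1) (λ k → sumℚ k (digit-term k)) ⟩
    ℚ.0ℚ ℚ.+ sumℚ (a ∸ 1) (λ m → sumℚ (suc m) (digit-term (suc m)))
      ≡⟨ ℚ.+-identityˡ _ ⟩
    sumℚ (a ∸ 1) (λ m → sumℚ (suc m) (digit-term (suc m)))
      ≡⟨ sumℚ-cong (a ∸ 1) (λ m _ → sumℚ-cong (suc m) λ i i≤m → cong (x ^ℚ_)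
           (trans (cong (λ s → weighted s (suc m * a + i)) (ℕ.m≥n⇒m⊔n≡m (ℕ.<⇒≤ i≤m))) (exponent h a d m i))) ⟩
    lower ∎
    where
    exponent : ∀ h a d m i → suc m * (h * (a * a)) + (suc m * a + i) * d
                           ≡ (m + 1) * h * (a * a) + ((m + 1) * a + i) * d
    exponent = solve-∀

  sumℚ-x^N≡upper+lower : ∀ (N : ℕ → ℕ) → (∀ r → r < c → IsN c generators r (N r)) →
                         sumℚ c (λ r → x ^ℚ N r) ≡ upper ℚ.+ lower
  sumℚ-x^N≡upper+lower N N-isN = begin
    sumℚ c (λ r → x ^ℚ N r)
      ≡⟨ sumℚ-cong c (λ r r<c → cong (x ^ℚ_) (IsN-unique {c} {generators} {r} (N-isN r r<c) (IsN-apéry r r<c))) ⟩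
    sumℚ c (λ r → x ^ℚ apéry (fromResidue r))
      ≡⟨ sumℚ-permute c (λ t → x ^ℚ apéry t) fromResidue toResidue
           (λ r _ → m%n<n (e * r) c) (λ t _ → m%n<n (d * t) c) fromResidue-toResidue toResidue-fromResidue ⟩
    sumℚ c (λ t → x ^ℚ apéry t)
      ≡⟨ sumℚ-x^apéry ⟩
    sumℚ a (λ k → sumℚ a (digit-term k))
      ≡⟨ sumℚ-cong a (λ k k<a → trans (cong (λ n → sumℚ n (digit-term k)) (sym (ℕ.m+[n∸m]≡n (ℕ.<⇒≤ k<a))))
                                      (sumℚ-split k (a ∸ k) (digit-term k))) ⟩
    sumℚ a (λ k → j<k k ℚ.+ j≥k k)        ≡⟨ sumℚ-distrib-+ a j<k j≥k ⟩
    sumℚ a j<k ℚ.+ sumℚ a j≥k             ≡⟨ ℚ.+-comm (sumℚ a j<k) (sumℚ a j≥k) ⟩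
    sumℚ a j≥k ℚ.+ sumℚ a j<k             ≡⟨ cong₂ ℚ._+_ sumℚ-j≥k≡upper sumℚ-j<k≡lower ⟩
    upper ℚ.+ lower                       ∎
    where
    j<k j≥k : ℕ → ℚ
    j<k k = sumℚ k (digit-term k)
    j≥k k = sumℚ (a ∸ k) (λ i → digit-term k (k + i))

open import Data.Nat using (ℕ; suc; _+_; _*_; _∸_; _<_; _≤_)
open import Data.Nat.GCD using (gcd)
open import Data.Rational as ℚ using (ℚ; 1ℚ)
open import Data.Product using (∃; _×_)
open import Data.List using (List; []; _∷_)
open import Relation.Binary.PropositionalEquality using (_≡_; _≢_)
open import Data.Product using (_,_)
open import Relation.Binary.PropositionalEquality using (trans)
import Data.Nat.Properties as ℕ

propositionA4 :
    ∀ (a h d : ℕ) → 1 < a → 1 ≤ h → 1 ≤ d → gcd a d ≡ 1 →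
    -- A = (a², ha²+d, ha²+ad, ha²+(a+1)d)
    let c  = a * a
        bs = (h * (a * a) + d) ∷ (h * (a * a) + a * d) ∷ (h * (a * a) + (a + 1) * d) ∷ []
    in
    -- the minima N_r exist for every residue 0 ≤ r ≤ a²-1
    (∀ r → r < c → ∃ λ N → IsN c bs r N)
    ×
    -- and, writing N r for N_r and f(x) = Σ_{r=0}^{a²-1} x^{N_r}:
    (∀ (N : ℕ → ℕ) → (∀ r → r < c → IsN c bs r (N r)) →
      ∀ (x : ℚ) →
      let f = sumℚ c (λ r → x ^ℚ N r)
          u = h * (a * a) + d
          v = h * (a * a) + a * d
          w = h * (a * a) + a * d + d
          one-x : ℕ → ℚ
          one-x k = 1ℚ ℚ.- x ^ℚ k
      in
      (f ≡ sumℚ a (λ m → sumℚ (a ∸ m) (λ i →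
                 x ^ℚ ((m + i) * h * (a * a) + (m * (a + 1) + i) * d)))
           ℚ.+ sumℚ (a ∸ 1) (λ m → sumℚ (suc m) (λ i →
                 x ^ℚ ((m + 1) * h * (a * a) + ((m + 1) * a + i) * d))))
      ×
      (x ≢ 1ℚ → x ≢ ℚ.- 1ℚ →
        f ≡ ((x ^ℚ (a * w) ℚ.- x ^ℚ (a * u)) ÷′ (one-x (a * d) ℚ.* one-x u))
            ℚ.+ ((1ℚ ℚ.- x ^ℚ (a * w)) ÷′ (one-x u ℚ.* one-x w))
            ℚ.+ ((x ^ℚ (a * w) ℚ.- x ^ℚ w) ÷′ (one-x w ℚ.* one-x d))
            ℚ.+ ((x ^ℚ v ℚ.- x ^ℚ ((a * a) * (h * a + d))) ÷′ (one-x v ℚ.* one-x d))))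
propositionA4 a h d 1<a _ 1≤d gcd[a,d]≡1 =
  (λ r r<c → apéry (fromResidue r) , IsN-apéry r r<c) ,
  λ N N-isN x →
    sumℚ-x^N≡upper+lower a h d 1<a gcd[a,d]≡1 x N N-isN ,
    λ x≢1 x≢-1 → trans (sumℚ-x^N≡upper+lower a h d 1<a gcd[a,d]≡1 x N N-isN)
                       (TriangleSums.closed-form a h d x (ℕ.<⇒≤ 1<a) 1≤d x≢1 x≢-1)
  where
  open ApérySet.Apéry a h d 1<a gcd[a,d]≡1
  open ApéryGeneratingFunction using (sumℚ-x^N≡upper+lower)
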